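{- Let $(G,\mathbf{w})$ be a connected weighted graph on vertex set $V$ with $n=|V|$ vertices. Then: (1) $c(G,\mathbf{w}) \geq \mathrm{diam}_\mathbf{w}(G)$; (2) $c(G,\mathbf{w}) \geq \lceil \log_2 |V|\rceil$; (3) $c(G,\mathbf{w}) \leq h_p(G,\mathbf{w})$; (4) $c(G,\mathbf{w}) \leq t\,(n-1)$, where $t = \min_{T} \max_{e\in T} w(e)$, the minimum being taken over all spanning trees $T$ of $G$.
   Context: A weighted graph $(G,\mathbf{w})$ is a finite simple graph with a weight function $\mathbf{w}:E(G)\to\mathbb{Z}_{>0}$ that is weight-minimal: every edge is a shortest (minimum total weight) path between its endpoints. $d_\mathbf{w}(u,v)$ denotes the minimum total weight of a $(u,v)$-path, and $\mathrm{diam}_\mathbf{w}(G)=\max_{u,v} d_\mathbf{w}(u,v)$. A binary addressing of $(G,\mathbf{w})$ of length $m$ is a map $f:V(G)\to\{0,1\}^m$ with $d_\mathbf{w}(u,v)\le d_H(f(u),f(v))$ for all $u,v$, where $d_H$ is Hamming distance; $c(G,\mathbf{w})$ is the minimum such $m$. $h_p(G,\mathbf{w})$ denotes the minimum total weight of a Hamilton path in the complete graph on $V(G)$ in which the edge $uv$ has weight $d_\mathbf{w}(u,v)$. -}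

module Defs where

open import Data.Nat using (ℕ; zero; suc; _+_; _*_; _≤_; _<_; _⊔_)
open import Data.Bool using (Bool; true; false; T; if_then_else_)
open import Data.Fin using (Fin)
open import Data.Vec using (Vec; []; _∷_)
open import Data.List using (List; []; _∷_; allFin; length; concatMap; foldr; map)
open import Data.List.Relation.Unary.Unique.Propositional using (Unique)
open import Data.List.Membership.Propositional using (_∈_)
open import Data.Product using (Σ; _×_; _,_)
open import Relation.Binary.PropositionalEquality using (_≡_; _≢_)

-- A graph on vertex set Fin n is given by a Bool-valued adjacency relation E.
-- A weight function w is given on ordered pairs; only its values on edges matter.

module _ {n : ℕ} (E : Fin n → Fin n → Bool) where

  data Walk : Fin n → Fin n → Set where
    stop : (u : Fin n) → Walk u u
    step : (u : Fin n) {v x : Fin n} → T (E u v) → Walk v x → Walk u x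

  vertices : {u v : Fin n} → Walk u v → List (Fin n)
  vertices (stop u) = u ∷ []
  vertices (step u _ p) = u ∷ vertices p

  IsPath : {u v : Fin n} → Walk u v → Set
  IsPath p = Unique (vertices p)

  Connected : Set
  Connected = (u v : Fin n) → Walk u v

module _ {n : ℕ} (E : Fin n → Fin n → Bool) (w : Fin n → Fin n → ℕ) where

  weight : {u v : Fin n} → Walk E u v → ℕ
  weight (stop _) = 0
  weight (step u {v} _ p) = w u v + weight p

record IsWeightedGraph {n : ℕ} (E : Fin n → Fin n → Bool) (w : Fin n → Fin n → ℕ) : Set where
  field
    irrefl   : (u : Fin n) → E u u ≡ false
    symE     : (u v : Fin n) → E u v ≡ E v u
    symW     : (u v : Fin n) → T (E u v) → w u v ≡ w v u
    positive : (u v : Fin n) → T (E u v) → 0 < w u v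
    minimal  : (u v : Fin n) → T (E u v) → (p : Walk E u v) → IsPath E p → w u v ≤ weight E w p

IsDistance : {n : ℕ} (E : Fin n → Fin n → Bool) (w : Fin n → Fin n → ℕ) → (Fin n → Fin n → ℕ) → Set
IsDistance {n} E w d = (u v : Fin n) →
  Σ (Walk E u v) (λ p → IsPath E p × weight E w p ≡ d u v)
  × ((p : Walk E u v) → IsPath E p → d u v ≤ weight E w p)

IsMinimum : (ℕ → Set) → ℕ → Set
IsMinimum P c = P c × ((m : ℕ) → P m → c ≤ m)

maxList : List ℕ → ℕ
maxList = foldr _⊔_ 0

allPairs : (n : ℕ) → List (Fin n × Fin n)
allPairs n = concatMap (λ u → map (λ v → u , v) (allFin n)) (allFin n)

diam : {n : ℕ} → (Fin n → Fin n → ℕ) → ℕ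
diam {n} d = maxList (map (λ { (u , v) → d u v }) (allPairs n))

hamming : {m : ℕ} → Vec Bool m → Vec Bool m → ℕ
hamming [] [] = 0
hamming (true ∷ xs) (true ∷ ys) = hamming xs ys
hamming (false ∷ xs) (false ∷ ys) = hamming xs ys
hamming (true ∷ xs) (false ∷ ys) = suc (hamming xs ys)
hamming (false ∷ xs) (true ∷ ys) = suc (hamming xs ys)

HasAddressing : {n : ℕ} → (Fin n → Fin n → ℕ) → ℕ → Set
HasAddressing {n} d m =
  Σ (Fin n → Vec Bool m) (λ f → (u v : Fin n) → d u v ≤ hamming (f u) (f v))

-- Hamilton paths in the complete graph on Fin n: orderings of all vertices
IsHamiltonOrder : {n : ℕ} → List (Fin n) → Set
IsHamiltonOrder {n} xs = Unique xs × ((v : Fin n) → v ∈ xs)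

seqWeight : {n : ℕ} → (Fin n → Fin n → ℕ) → List (Fin n) → ℕ
seqWeight d [] = 0
seqWeight d (x ∷ []) = 0
seqWeight d (x ∷ y ∷ xs) = d x y + seqWeight d (y ∷ xs)

HamiltonWeight : {n : ℕ} → (Fin n → Fin n → ℕ) → ℕ → Set
HamiltonWeight d h = Σ _ (λ xs → IsHamiltonOrder xs × seqWeight d xs ≡ h)

record IsSpanningTree {n : ℕ} (E Tr : Fin n → Fin n → Bool) : Set where
  field
    subgraph  : (u v : Fin n) → T (Tr u v) → T (E u v)
    symT      : (u v : Fin n) → Tr u v ≡ Tr v u
    connected : Connected Tr
    -- acyclic: no cycle, i.e. no tree edge uv together with a path from v to u
    -- in Tr having at least 3 vertices
    acyclic   : (u v : Fin n) → T (Tr u v) → (p : Walk Tr v u) → IsPath Tr p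
                → length (vertices Tr p) ≤ 2

maxEdgeWeight : {n : ℕ} → (Fin n → Fin n → ℕ) → (Fin n → Fin n → Bool) → ℕ
maxEdgeWeight {n} w Tr =
  maxList (map (λ { (u , v) → if Tr u v then w u v else 0 }) (allPairs n))

TreeBottleneck : {n : ℕ} → (Fin n → Fin n → Bool) → (Fin n → Fin n → ℕ) → ℕ → Set
TreeBottleneck {n} E w t =
  Σ (Fin n → Fin n → Bool) (λ Tr → IsSpanningTree E Tr × maxEdgeWeight w Tr ≡ t)

{-# OPTIONS --safe #-}
module Submission where

open import Defs
open import Data.Nat using (ℕ; zero; suc; _+_; _*_; _∸_; _^_; _≤_; _<_; z≤n; s≤s; _≤?_)
open import Data.Nat.Properties
  using ( ≤-refl; ≤-reflexive; ≤-trans; ≤-antisym; ≤-isPartialOrder; <⇒≢; ≮⇒≥; 1+n≰n; n≤0⇒n≡0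
        ; m≤n⇒m≤1+n; m≤m+n; m≤n+m; +-comm; +-assoc; +-suc; +-identityʳ; +-mono-≤; +-monoʳ-≤
        ; *-comm; *-monoˡ-≤; ∸-monoˡ-≤; m∸n+n≡m; ⊔-lub; m≤n⇒m≤n⊔o; m≤n⇒m≤o⊔n
        ; anyUpTo?; module ≤-Reasoning)
open import Data.Nat.Induction using (<-rec)
open import Data.Nat.Logarithm using (⌈log₂_⌉; ⌈log₂⌉-mono-≤; ⌈log₂2^n⌉≡n)
open import Data.Bool using (Bool; true; false; T)
open import Data.Bool.Properties using (T-≡; if-cong)
open import Data.Fin using (Fin; zero; suc; combine; _≟_)
open import Data.Fin.Properties using (2↔Bool; combine-injective; injective⇒≤; all?; ¬∀⟶∃¬)
open import Data.Vec using (Vec; []; _∷_; _++_; replicate; lookup; tabulate)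
open import Data.Vec.Properties using (lookup∘tabulate)
open import Data.List as List using (List; []; _∷_; length; allFin)
open import Data.List.Properties using (foldr-preservesᵇ; foldr-preservesᵒ)
open import Data.List.Relation.Unary.All as All using (All; []; universal)
open import Data.List.Relation.Unary.All.Properties using (map⁺; ¬Any⇒All¬)
open import Data.List.Relation.Unary.AllPairs using ([]; _∷_)
open import Data.List.Relation.Unary.Any as Any using (here; there)
open import Data.List.Relation.Unary.Unique.Propositional using (Unique)
open import Data.List.Relation.Unary.Unique.Propositional.Properties using (allFin⁺)
open import Data.List.Membership.Propositional using (_∈_; _∉_; lose)
open import Data.List.Membership.Propositional.Properties using (∈-map⁺; ∈-concatMap⁺; ∈-allFin; ∈-lookup)
open import Data.Product using (Σ; ∃; _×_; _,_; proj₁; proj₂)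
open import Data.Sum using (_⊎_; inj₁; inj₂; [_,_])
open import Data.Empty using (⊥-elim)
open import Function.Base using (_∘_)
open import Function.Bundles using (_↣_; mk↣; Injection; Equivalence)
open import Function.Properties.Inverse using (↔⇒↣; ↔-sym)
open import Function.Metric.Nat using (IsMetric)
open import Level using (0ℓ)
open import Relation.Nullary using (Dec; yes; no; ¬_)
open import Relation.Nullary.Decidable using (map′; _⊎-dec_)
open import Relation.Unary using (Pred; Decidable)
open import Relation.Binary.PropositionalEquality
  using (_≡_; refl; sym; trans; cong; cong₂; subst; subst₂; isEquivalence; module ≡-Reasoning)

-- Attaching a vertex x to an already addressed vertex y with d(x,y) ≤ a costs a extra bits: x gets
-- the code of y prefixed by a ones, every other vertex its own code prefixed by a zeros, and the
-- triangle inequality through y covers the new distances. Attaching the vertices of a Hamilton path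
-- one after the other gives (3); attaching vertices along spanning-tree edges, each of weight at
-- most t, gives (4). Distinct vertices are at positive distance, so an addressing of length c is
-- injective and n ≤ 2^c, which is (2); (1) holds because words of length c are at Hamming distance
-- at most c. The least length exists because having an addressing of a given length is decidable
-- (there are finitely many code tables) and a Hamilton path provides one.

hamming-self : ∀ {m} (xs : Vec Bool m) → hamming xs xs ≡ 0
hamming-self []           = refl
hamming-self (true  ∷ xs) = hamming-self xs
hamming-self (false ∷ xs) = hamming-self xs

hamming-comm : ∀ {m} (xs ys : Vec Bool m) → hamming xs ys ≡ hamming ys xs
hamming-comm []           []           = refl
hamming-comm (true  ∷ xs) (true  ∷ ys) = hamming-comm xs ys
hamming-comm (true  ∷ xs) (false ∷ ys) = cong suc (hamming-comm xs ys)
hamming-comm (false ∷ xs) (true  ∷ ys) = cong suc (hamming-comm xs ys)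
hamming-comm (false ∷ xs) (false ∷ ys) = hamming-comm xs ys

hamming-++ : ∀ {m k} (xs ys : Vec Bool m) (xs′ ys′ : Vec Bool k) →
             hamming (xs ++ xs′) (ys ++ ys′) ≡ hamming xs ys + hamming xs′ ys′
hamming-++ []           []           xs′ ys′ = refl
hamming-++ (true  ∷ xs) (true  ∷ ys) xs′ ys′ = hamming-++ xs ys xs′ ys′
hamming-++ (true  ∷ xs) (false ∷ ys) xs′ ys′ = cong suc (hamming-++ xs ys xs′ ys′)
hamming-++ (false ∷ xs) (true  ∷ ys) xs′ ys′ = cong suc (hamming-++ xs ys xs′ ys′)
hamming-++ (false ∷ xs) (false ∷ ys) xs′ ys′ = hamming-++ xs ys xs′ ys′

hamming-prefix : ∀ {m k} (zs : Vec Bool k) (xs ys : Vec Bool m) →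
                 hamming (zs ++ xs) (zs ++ ys) ≡ hamming xs ys
hamming-prefix zs xs ys = trans (hamming-++ zs zs xs ys) (cong (_+ hamming xs ys) (hamming-self zs))

hamming-replicate-true-false : ∀ a → hamming (replicate a true) (replicate a false) ≡ a
hamming-replicate-true-false zero    = refl
hamming-replicate-true-false (suc a) = cong suc (hamming-replicate-true-false a)

hamming≤length : ∀ {m} (xs ys : Vec Bool m) → hamming xs ys ≤ m
hamming≤length []           []           = z≤n
hamming≤length (true  ∷ xs) (true  ∷ ys) = m≤n⇒m≤1+n (hamming≤length xs ys)
hamming≤length (true  ∷ xs) (false ∷ ys) = s≤s (hamming≤length xs ys)
hamming≤length (false ∷ xs) (true  ∷ ys) = s≤s (hamming≤length xs ys)
hamming≤length (false ∷ xs) (false ∷ ys) = m≤n⇒m≤1+n (hamming≤length xs ys)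

Searchable : Set → Set₁
Searchable A = {P : Pred A 0ℓ} → Decidable P → Dec (∃ P)

Bool-searchable : Searchable Bool
Bool-searchable {P} P? = map′ [ (true ,_) , (false ,_) ] from (P? true ⊎-dec P? false)
  where
  from : ∃ P → P true ⊎ P false
  from (true  , p) = inj₁ p
  from (false , p) = inj₂ p

Vec-searchable : ∀ {A} → Searchable A → ∀ k → Searchable (Vec A k)
Vec-searchable search zero    P? = map′ ([] ,_) (λ { ([] , p) → p }) (P? [])
Vec-searchable search (suc k) P? =
  map′ (λ (a , (as , p)) → a ∷ as , p) (λ { (a ∷ as , p) → a , as , p })
       (search (λ a → Vec-searchable search k (λ as → P? (a ∷ as))))

least-satisfying : {P : Pred ℕ 0ℓ} → Decidable P → ∀ {b} → P b → Σ ℕ (IsMinimum P)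
least-satisfying {P} P? {b} = <-rec (λ b → P b → Σ ℕ (IsMinimum P)) least b
  where
  least : ∀ b → (∀ {m} → m < b → P m → Σ ℕ (IsMinimum P)) → P b → Σ ℕ (IsMinimum P)
  least b below Pb with anyUpTo? P? b
  ... | yes (m , m<b , Pm) = below m<b Pm
  ... | no ∄smaller        = b , Pb , λ m Pm → ≮⇒≥ (λ m<b → ∄smaller (m , m<b , Pm))

Vec↣Fin^ : ∀ {A : Set} {k} → A ↣ Fin k → ∀ c → Vec A c ↣ Fin (k ^ c)
Vec↣Fin^ {A} {k} A↣ c = mk↣ {to = encode} (encode-injective _ _)
  where
  open Injection A↣ using (to; injective)
  encode : ∀ {c} → Vec A c → Fin (k ^ c)
  encode []       = zero
  encode (a ∷ as) = combine (to a) (encode as)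
  encode-injective : ∀ {c} (as bs : Vec A c) → encode as ≡ encode bs → as ≡ bs
  encode-injective []       []       _  = refl
  encode-injective (a ∷ as) (b ∷ bs) eq with combine-injective (to a) (encode as) (to b) (encode bs) eq
  ... | a≡b , as≡bs = cong₂ _∷_ (injective a≡b) (encode-injective as bs as≡bs)

lookup-injective : ∀ {A : Set} {xs : List A} → Unique xs →
                   ∀ {i j} → List.lookup xs i ≡ List.lookup xs j → i ≡ j
lookup-injective (_ ∷ _)      {zero}  {zero}  _  = refl
lookup-injective (x∉xs ∷ _)   {zero}  {suc j} eq = ⊥-elim (All.lookup x∉xs (∈-lookup j) eq)
lookup-injective (x∉xs ∷ _)   {suc i} {zero}  eq = ⊥-elim (All.lookup x∉xs (∈-lookup i) (sym eq))
lookup-injective (_ ∷ unique) {suc i} {suc j} eq = cong suc (lookup-injective unique eq)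

Unique⇒length≤ : ∀ {n} {xs : List (Fin n)} → Unique xs → length xs ≤ n
Unique⇒length≤ unique = injective⇒≤ (lookup-injective unique)

maxList-lub : ∀ {c} {xs : List ℕ} → All (_≤ c) xs → maxList xs ≤ c
maxList-lub = foldr-preservesᵇ ⊔-lub z≤n

≤maxList : ∀ {x} {xs : List ℕ} → x ∈ xs → x ≤ maxList xs
≤maxList {xs = xs} x∈xs =
  foldr-preservesᵒ (λ a b → [ m≤n⇒m≤n⊔o b , m≤n⇒m≤o⊔n a ]) 0 xs (inj₂ (Any.map ≤-reflexive x∈xs))

∈-allPairs : ∀ {n} (u v : Fin n) → (u , v) ∈ allPairs n
∈-allPairs u v = ∈-concatMap⁺ _ (lose (∈-allFin u) (∈-map⁺ (u ,_) (∈-allFin v)))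

module _ {n : ℕ} {E : Fin n → Fin n → Bool} where
  open import Data.List.Membership.DecPropositional (_≟_ {n}) using (_∈?_)

  _++ʷ_ : ∀ {u v x} → Walk E u v → Walk E v x → Walk E u x
  stop _     ++ʷ q = q
  step u e p ++ʷ q = step u e (p ++ʷ q)

  crossingEdge : {P : Pred (Fin n) 0ℓ} → Decidable P → ∀ {a b} → Walk E a b → P a → ¬ P b →
                 Σ (Fin n) λ y → Σ (Fin n) λ x → P y × ¬ P x × T (E y x)
  crossingEdge P? (stop _)         Pa ¬Pb = ⊥-elim (¬Pb Pa)
  crossingEdge P? (step a {c} e p) Pa ¬Pb with P? c
  ... | yes Pc = crossingEdge P? p Pc ¬Pb
  ... | no ¬Pc = a , c , Pa , ¬Pc , e

  module _ (w : Fin n → Fin n → ℕ) where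

    weight-++ : ∀ {u v x} (p : Walk E u v) (q : Walk E v x) →
                weight E w (p ++ʷ q) ≡ weight E w p + weight E w q
    weight-++ (stop _)         q = refl
    weight-++ (step u {v} e p) q = trans (cong (w u v +_) (weight-++ p q)) (sym (+-assoc (w u v) _ _))

    suffixPath : ∀ {a v u} (p : Walk E a v) → IsPath E p → u ∈ vertices E p →
                 Σ (Walk E u v) λ q → IsPath E q × weight E w q ≤ weight E w p
    suffixPath p@(stop _)       p-path       (here refl) = p , p-path , ≤-refl
    suffixPath p@(step _ _ _)   p-path       (here refl) = p , p-path , ≤-refl
    suffixPath (step a {b} e p) (_ ∷ p-path) (there u∈p) with suffixPath p p-path u∈p
    ... | q , q-path , q≤p = q , q-path , ≤-trans q≤p (m≤n+m _ (w a b))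

    toPath : ∀ {u v} (p : Walk E u v) → Σ (Walk E u v) λ q → IsPath E q × weight E w q ≤ weight E w p
    toPath (stop u) = stop u , [] ∷ [] , ≤-refl
    toPath (step u {b} e p) with toPath p
    ... | q , q-path , q≤p with u ∈? vertices E q
    ...   | yes u∈q = let r , r-path , r≤q = suffixPath q q-path u∈q
                      in r , r-path , ≤-trans r≤q (≤-trans q≤p (m≤n+m _ (w u b)))
    ...   | no u∉q  = step u e q , ¬Any⇒All¬ _ u∉q ∷ q-path , +-monoʳ-≤ (w u b) q≤p

module GraphDistance {n : ℕ} {E : Fin n → Fin n → Bool} {w : Fin n → Fin n → ℕ}
                     (G : IsWeightedGraph E w) {d : Fin n → Fin n → ℕ} (D : IsDistance E w d) where
  open IsWeightedGraph G

  reverse : ∀ {u v} → Walk E u v → Walk E v u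
  reverse (stop u)         = stop u
  reverse (step u {v} e p) = reverse p ++ʷ step v (subst T (symE u v) e) (stop u)

  weight-reverse : ∀ {u v} (p : Walk E u v) → weight E w (reverse p) ≡ weight E w p
  weight-reverse (stop u)         = refl
  weight-reverse (step u {v} e p) = begin
    weight E w (reverse p ++ʷ step v _ (stop u)) ≡⟨ weight-++ w (reverse p) _ ⟩
    weight E w (reverse p) + (w v u + 0)         ≡⟨ cong₂ _+_ (weight-reverse p)
                                                            (trans (+-identityʳ _) (sym (symW u v e))) ⟩
    weight E w p + w u v                         ≡⟨ +-comm _ (w u v) ⟩
    w u v + weight E w p                         ∎
    where open ≡-Reasoning

  d≤weight : ∀ {u v} (p : Walk E u v) → d u v ≤ weight E w p
  d≤weight p with toPath w p
  ... | q , q-path , q≤p = ≤-trans (proj₂ (D _ _) q q-path) q≤p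

  d≤w : ∀ {u v} → T (E u v) → d u v ≤ w u v
  d≤w {u} {v} e = ≤-trans (d≤weight (step u e (stop v))) (≤-reflexive (+-identityʳ (w u v)))

  shortestWalk : ∀ u v → Σ (Walk E u v) λ p → weight E w p ≡ d u v
  shortestWalk u v with proj₁ (D u v)
  ... | p , _ , p≡d = p , p≡d

  d-definite : ∀ {u v} → u ≡ v → d u v ≡ 0
  d-definite {u} refl = n≤0⇒n≡0 (d≤weight (stop u))

  d-indiscernible : ∀ {u v} → d u v ≡ 0 → u ≡ v
  d-indiscernible {u} {v} d≡0 with shortestWalk u v
  ... | stop _ , _ = refl
  ... | step _ {b} e p , p≡d =
    ⊥-elim (<⇒≢ (≤-trans (positive u b e) (m≤m+n (w u b) _)) (sym (trans p≡d d≡0)))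

  d-sym-≤ : ∀ u v → d v u ≤ d u v
  d-sym-≤ u v with shortestWalk u v
  ... | p , p≡d = ≤-trans (d≤weight (reverse p)) (≤-reflexive (trans (weight-reverse p) p≡d))

  d-triangle : ∀ u v x → d u x ≤ d u v + d v x
  d-triangle u v x with shortestWalk u v | shortestWalk v x
  ... | p , p≡d | q , q≡d =
    ≤-trans (d≤weight (p ++ʷ q)) (≤-reflexive (trans (weight-++ w p q) (cong₂ _+_ p≡d q≡d)))

  d-isMetric : IsMetric _≡_ d
  d-isMetric = record
    { isSemiMetric = record
      { isQuasiSemiMetric = record
        { isPreMetric = record
          { isProtoMetric = record
            { isPartialOrder  = ≤-isPartialOrder
            ; ≈-isEquivalence = isEquivalence
            ; cong            = cong₂ d
            ; nonNegative     = z≤n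
            }
          ; ≈⇒0 = d-definite
          }
        ; 0⇒≈ = d-indiscernible
        }
      ; sym = λ u v → ≤-antisym (d-sym-≤ v u) (d-sym-≤ u v)
      }
    ; triangle = d-triangle
    }

edge≤maxEdgeWeight : ∀ {n} (w : Fin n → Fin n → ℕ) {Tr : Fin n → Fin n → Bool} {u v} →
                     T (Tr u v) → w u v ≤ maxEdgeWeight w Tr
edge≤maxEdgeWeight w {Tr} {u} {v} uv =
  subst (_≤ maxEdgeWeight w Tr) (if-cong (Equivalence.to T-≡ uv))
        (≤maxList (∈-map⁺ _ (∈-allPairs u v)))

module _ {n : ℕ} (d : Fin n → Fin n → ℕ) where

  IsAddressing : ∀ {m} → (Fin n → Vec Bool m) → Set
  IsAddressing f = ∀ u v → d u v ≤ hamming (f u) (f v)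

  hasAddressing? : ∀ m → Dec (HasAddressing d m)
  hasAddressing? m =
    map′ (λ (codes , ok) → lookup codes , ok) (λ (f , ok) → tabulate f , tabulated ok)
         (Vec-searchable (Vec-searchable Bool-searchable m) n isAddressing?)
    where
    isAddressing? : Decidable (λ codes → IsAddressing (lookup codes))
    isAddressing? codes = all? λ u → all? λ v → d u v ≤? hamming (lookup codes u) (lookup codes v)
    tabulated : ∀ {f} → IsAddressing f → IsAddressing (lookup (tabulate f))
    tabulated {f} ok u v =
      subst₂ (λ x y → d u v ≤ hamming x y) (sym (lookup∘tabulate f u)) (sym (lookup∘tabulate f v))
             (ok u v)

  padding : ∀ k {m} → HasAddressing d m → HasAddressing d (k + m)
  padding k (f , ok) = (λ v → replicate k false ++ f v) ,
    λ u v → subst (d u v ≤_) (sym (hamming-prefix (replicate k false) (f u) (f v))) (ok u v)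

  hasAddressing-mono : ∀ {m m′} → m ≤ m′ → HasAddressing d m → HasAddressing d m′
  hasAddressing-mono {m} {m′} m≤m′ A = subst (HasAddressing d) (m∸n+n≡m m≤m′) (padding (m′ ∸ m) A)

  diam≤length : ∀ {m} → HasAddressing d m → diam d ≤ m
  diam≤length (f , ok) =
    maxList-lub (map⁺ (universal (λ (u , v) → ≤-trans (ok u v) (hamming≤length (f u) (f v))) (allPairs n)))

hasAddressing-fromVertex : ∀ {n m} {d : Fin n → Fin n → ℕ} →
                           (Fin n → HasAddressing d m) → HasAddressing d m
hasAddressing-fromVertex {zero}  _ = (λ ()) , λ ()
hasAddressing-fromVertex {suc n} A = A zero

module _ {n : ℕ} {d : Fin n → Fin n → ℕ} (d-metric : IsMetric _≡_ d) where
  open IsMetric d-metric using (triangle; ≈⇒0; 0⇒≈) renaming (sym to d-sym)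
  open import Data.List.Membership.DecPropositional (_≟_ {n}) using (_∈?_)

  addressing-injective : ∀ {m} {f : Fin n → Vec Bool m} → IsAddressing d f →
                         ∀ {u v} → f u ≡ f v → u ≡ v
  addressing-injective {f = f} ok {u} {v} fu≡fv = 0⇒≈ (n≤0⇒n≡0 (begin
    d u v               ≤⟨ ok u v ⟩
    hamming (f u) (f v) ≡⟨ cong (λ x → hamming x (f v)) fu≡fv ⟩
    hamming (f v) (f v) ≡⟨ hamming-self (f v) ⟩
    0                   ∎))
    where open ≤-Reasoning

  ⌈log₂⌉≤length : ∀ {c} → HasAddressing d c → ⌈log₂ n ⌉ ≤ c
  ⌈log₂⌉≤length {c} (f , ok) = begin
    ⌈log₂ n ⌉       ≤⟨ ⌈log₂⌉-mono-≤ n≤2^c ⟩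
    ⌈log₂ (2 ^ c) ⌉ ≡⟨ ⌈log₂2^n⌉≡n c ⟩
    c               ∎
    where
    open ≤-Reasoning
    open Injection (Vec↣Fin^ (↔⇒↣ (↔-sym 2↔Bool)) c) using (to; injective)
    n≤2^c : n ≤ 2 ^ c
    n≤2^c = injective⇒≤ {f = to ∘ f} (addressing-injective {f = f} ok ∘ injective)

  AddressingOn : List (Fin n) → ℕ → Set
  AddressingOn S m =
    Σ (Fin n → Vec Bool m) λ f → ∀ {u v} → u ∈ S → v ∈ S → d u v ≤ hamming (f u) (f v)

  addressingOn-[_] : ∀ x → AddressingOn (x ∷ []) 0
  addressingOn-[ x ] = (λ _ → []) , λ { (here refl) (here refl) → ≤-reflexive (≈⇒0 refl) }

  spanning : ∀ {S m} → (∀ v → v ∈ S) → AddressingOn S m → HasAddressing d m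
  spanning covers (f , ok) = f , λ u v → ok (covers u) (covers v)

  extend : ∀ {S m x y a} → AddressingOn S m → y ∈ S → d x y ≤ a → AddressingOn (x ∷ S) (a + m)
  extend {S} {m} {x} {y} {a} (f , ok) y∈S dxy≤a = code , code-ok
    where
    ones zeros : Vec Bool a
    ones  = replicate a true
    zeros = replicate a false

    code : Fin n → Vec Bool (a + m)
    code v with v ≟ x
    ... | yes _ = ones  ++ f y
    ... | no  _ = zeros ++ f v

    new-old : ∀ {v} → v ∈ S → d x v ≤ hamming (ones ++ f y) (zeros ++ f v)
    new-old {v} v∈S = begin
      d x v                                      ≤⟨ triangle x y v ⟩
      d x y + d y v                              ≤⟨ +-mono-≤ dxy≤a (ok y∈S v∈S) ⟩
      a + hamming (f y) (f v)                    ≡⟨ cong (_+ _) (sym (hamming-replicate-true-false a)) ⟩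
      hamming ones zeros + hamming (f y) (f v)   ≡⟨ sym (hamming-++ ones zeros (f y) (f v)) ⟩
      hamming (ones ++ f y) (zeros ++ f v)       ∎
      where open ≤-Reasoning

    code-ok : ∀ {u v} → u ∈ x ∷ S → v ∈ x ∷ S → d u v ≤ hamming (code u) (code v)
    code-ok {u} {v} u∈ v∈ with u ≟ x | v ≟ x
    ... | yes refl | yes refl = ≤-trans (≤-reflexive (≈⇒0 refl)) z≤n
    ... | yes refl | no v≢x   = new-old (Any.tail v≢x v∈)
    ... | no u≢x   | yes refl =
      subst₂ _≤_ (d-sym x u) (hamming-comm (ones ++ f y) (zeros ++ f u)) (new-old (Any.tail u≢x u∈))
    ... | no u≢x   | no v≢x   =
      subst (d u v ≤_) (sym (hamming-prefix zeros (f u) (f v))) (ok (Any.tail u≢x u∈) (Any.tail v≢x v∈))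

  sequenceAddressing : (xs : List (Fin n)) → AddressingOn xs (seqWeight d xs)
  sequenceAddressing []           = (λ _ → []) , λ ()
  sequenceAddressing (x ∷ [])     = addressingOn-[ x ]
  sequenceAddressing (x ∷ y ∷ xs) = extend (sequenceAddressing (y ∷ xs)) (here refl) ≤-refl

  module _ {H : Fin n → Fin n → Bool} (H-connected : Connected H)
           {t : ℕ} (H-short : ∀ {u v} → T (H u v) → d u v ≤ t) where

    coveredOrExtensible : ∀ {s} S → s ∈ S →
                          (∀ v → v ∈ S) ⊎ Σ (Fin n) λ x → Σ (Fin n) λ y → x ∉ S × y ∈ S × d x y ≤ t
    coveredOrExtensible {s} S s∈S with all? (_∈? S)
    ... | yes covers = inj₁ covers
    ... | no ¬covers with ¬∀⟶∃¬ n _ (_∈? S) ¬covers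
    ...   | v , v∉S with crossingEdge (_∈? S) (H-connected s v) s∈S v∉S
    ...     | y , x , y∈S , x∉S , yx = inj₂ (x , y , x∉S , y∈S , subst (_≤ t) (d-sym y x) (H-short yx))

    -- The budget only serves termination: a duplicate-free list has at most n entries.
    grow : ∀ budget {s S} → Unique (s ∷ S) → n ≤ budget + length (s ∷ S) →
           AddressingOn (s ∷ S) (length S * t) → HasAddressing d ((n ∸ 1) * t)
    grow budget {s} {S} unique bound A with coveredOrExtensible (s ∷ S) (here refl) | budget
    ... | inj₁ covers | _ =
      hasAddressing-mono d (*-monoˡ-≤ t (∸-monoˡ-≤ 1 (Unique⇒length≤ unique))) (spanning covers A)
    ... | inj₂ (x , y , x∉S , y∈S , dxy≤t) | zero =
      ⊥-elim (1+n≰n (≤-trans (Unique⇒length≤ (¬Any⇒All¬ _ x∉S ∷ unique)) bound))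
    ... | inj₂ (x , y , x∉S , y∈S , dxy≤t) | suc budget′ =
      grow budget′ (¬Any⇒All¬ _ x∉S ∷ unique) (subst (n ≤_) (sym (+-suc budget′ _)) bound)
           (extend A y∈S dxy≤t)

    connectedAddressing : HasAddressing d ((n ∸ 1) * t)
    connectedAddressing =
      hasAddressing-fromVertex λ s → grow n ([] ∷ []) (m≤m+n n 1) addressingOn-[ s ]

lemma1 : (n : ℕ) (E : Fin n → Fin n → Bool) (w : Fin n → Fin n → ℕ)
         → IsWeightedGraph E w → Connected E
         → (d : Fin n → Fin n → ℕ) → IsDistance E w d
         → Σ ℕ (λ c → IsMinimum (HasAddressing d) c
             × diam d ≤ c
             × ⌈log₂ n ⌉ ≤ c
             × ((h : ℕ) → IsMinimum (HamiltonWeight d) h → c ≤ h)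
             × ((t : ℕ) → IsMinimum (TreeBottleneck E w) t → c ≤ t * (n ∸ 1)))
lemma1 n E w G _ d D =
  let c , c-minimum@(c-addr , c-least) =
        least-satisfying (hasAddressing? d) (hamiltonAddressing everyVertexOnce)
  in c , c-minimum , diam≤length d c-addr , ⌈log₂⌉≤length d-isMetric c-addr ,
     (λ h (H , _) → c-least h (hamiltonAddressing H)) ,
     (λ t (Tr , _) → c-least _ (treeAddressing Tr))
  where
  open GraphDistance G D using (d-isMetric; d≤w)

  hamiltonAddressing : ∀ {h} → HamiltonWeight d h → HasAddressing d h
  hamiltonAddressing (xs , (_ , covers) , refl) =
    spanning d-isMetric covers (sequenceAddressing d-isMetric xs)

  treeAddressing : ∀ {t} → TreeBottleneck E w t → HasAddressing d (t * (n ∸ 1))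
  treeAddressing (Tr , tree , refl) =
    subst (HasAddressing d) (*-comm (n ∸ 1) (maxEdgeWeight w Tr))
      (connectedAddressing d-isMetric (connected tree)
         λ uv → ≤-trans (d≤w (subgraph tree _ _ uv)) (edge≤maxEdgeWeight w {Tr} uv))
    where open IsSpanningTree

  everyVertexOnce : HamiltonWeight d (seqWeight d (allFin n))
  everyVertexOnce = allFin n , (allFin⁺ n , ∈-allFin) , refl
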